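{- For any LTL formula $\varphi$ (in negation normal form) that does not contain any subformula of the form $\mathbf{X}(\chi \mathbin{\mathbf{U}} \chi')$, the automaton $\mathcal{A}_\varphi$ is a simple linear weak alternating automaton.
   Context: Fix a finite set $\mathcal{V}$ of atomic propositions. LTL formulas in negation normal form are built from literals ($v$ or $\lnot v$ for $v \in \mathcal{V}$) using $\land$, $\lor$, $\mathbf{X}$ (next), $\mathbf{U}$ (until) and $\mathbf{V}$ (release). A set $S$ of propositions/locations is identified with the Boolean valuation making exactly its elements true; "$S \models \theta$" means this valuation satisfies the propositional formula $\theta$. An alternating $\omega$-automaton is $(Q, q_0, \delta, Acc)$ with $Q$ a finite set of locations disjoint from $\mathcal{V}$, $q_0 \in Q$, $\delta$ assigning to each $q \in Q$ a propositional formula $\delta(q)$ over $Q \cup \mathcal{V}$ in which locations occur only positively, and $Acc \subseteq Q^\omega$. Write $q \to q'$ if $q'$ occurs in $\delta(q)$. A (co-Büchi) linear weak alternating automaton (LWAA) is $(Q, q_0, \delta, F)$ with $F \subseteq Q$ such that the relation $q' \preceq q$ iff $q \to^* q'$ is a partial order on $Q$ (acceptance: a path is accepting iff it visits $F$ only finitely often). An LWAA $(Q, q_0, \delta, F)$ is simple if for all $q \in F$, all $q' \in Q$, all states $s \subseteq \mathcal{V}$, and all $X, Y \subseteq Q$ with $q \notin X$, $q \notin Y$: if $s \cup X \cup \{q\} \models \delta(q')$ and $s \cup Y \models \delta(q)$, then $s \cup X \cup Y \models \delta(q')$. For an LTL formula $\varphi$ in negation normal form, $\mathcal{A}_\varphi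 = (Q, q_\varphi, \delta, F)$ where $Q$ contains one location $q_\psi$ for every subformula $\psi$ of $\varphi$, the initial location is $q_\varphi$, $F = \{q_{\psi \mathbin{\mathbf{U}} \chi} \in Q\}$ (locations of until-subformulas), and $\delta$ is defined by: $\delta(q_\psi) = \psi$ for a literal $\psi$; $\delta(q_{\psi\land\chi}) = \delta(q_\psi) \land \delta(q_\chi)$; $\delta(q_{\psi\lor\chi}) = \delta(q_\psi) \lor \delta(q_\chi)$; $\delta(q_{\mathbf{X}\psi}) = q_\psi$; $\delta(q_{\psi \mathbin{\mathbf{U}} \chi}) = \delta(q_\chi) \lor (\delta(q_\psi) \land q_{\psi \mathbin{\mathbf{U}} \chi})$; $\delta(q_{\psi \mathbin{\mathbf{V}} \chi}) = \delta(q_\chi) \land (\delta(q_\psi) \lor q_{\psi \mathbin{\mathbf{V}} \chi})$. -}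

module Defs where

open import Level using (0ℓ)
open import Data.Nat using (ℕ)
open import Data.Fin using (Fin)
open import Data.Product using (Σ; _×_; ∃; ∃₂)
open import Data.Sum using (_⊎_)
open import Data.Empty using (⊥)
open import Relation.Nullary using (¬_)
open import Relation.Unary using (Pred; _∈_; _∉_; _⊆_; _∪_; ｛_｝)
open import Relation.Binary.PropositionalEquality using (_≡_)
open import Relation.Binary.Construct.Closure.ReflexiveTransitive using (Star)

data PF (V L : Set) : Set where
  pos  : V → PF V L
  neg  : V → PF V L
  loc  : L → PF V L
  _∧ᵖ_ : PF V L → PF V L → PF V L
  _∨ᵖ_ : PF V L → PF V L → PF V L

-- s ∪ X ⊨ θ  where s ⊆ V is a state and X ⊆ L a set of locations
-- (the union is identified with the Boolean valuation making exactly
-- its elements true).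
Sat : {V L : Set} → Pred V 0ℓ → Pred L 0ℓ → PF V L → Set
Sat s X (pos v)    = v ∈ s
Sat s X (neg v)    = v ∉ s
Sat s X (loc q)    = q ∈ X
Sat s X (θ ∧ᵖ θ′)  = Sat s X θ × Sat s X θ′
Sat s X (θ ∨ᵖ θ′)  = Sat s X θ ⊎ Sat s X θ′

Occurs : {V L : Set} → L → PF V L → Set
Occurs q (pos v)   = ⊥
Occurs q (neg v)   = ⊥
Occurs q (loc q′)  = q ≡ q′
Occurs q (θ ∧ᵖ θ′) = Occurs q θ ⊎ Occurs q θ′
Occurs q (θ ∨ᵖ θ′) = Occurs q θ ⊎ Occurs q θ′

-- Alternating automata with co-Büchi set F (the acceptance condition
-- Acc is determined by F).  Locations are drawn from a carrier type L;
-- the finite location set is the predicate Q on L.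

record LWAAData (V L : Set) : Set₁ where
  field
    Q  : Pred L 0ℓ
    q₀ : L
    δ  : L → PF V L
    F  : Pred L 0ℓ

module _ {V L : Set} (A : LWAAData V L) where
  open LWAAData A

  Step : L → L → Set
  Step q q′ = Occurs q′ (δ q)

  -- (Q, q₀, δ, F) is a well-formed automaton whose reachability
  -- order  q' ⪯ q ⇔ q →* q'  is a partial order on Q (reflexivity and
  -- transitivity hold by construction; antisymmetry is required), i.e.
  -- a linear weak alternating automaton.
  record IsLWAA : Set where
    field
      q₀∈Q    : q₀ ∈ Q
      F⊆Q     : F ⊆ Q
      δ-in-Q  : ∀ {q q′} → q ∈ Q → Step q q′ → q′ ∈ Q
      antisym : ∀ {q q′} → q ∈ Q → q′ ∈ Q →
                Star Step q q′ → Star Step q′ q → q ≡ q′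

  IsSimple : Set₁
  IsSimple =
    ∀ (q q′ : L) (s : Pred V 0ℓ) (X Y : Pred L 0ℓ) →
    q ∈ F → q′ ∈ Q → X ⊆ Q → Y ⊆ Q → q ∉ X → q ∉ Y →
    Sat s (X ∪ ｛ q ｝) (δ q′) → Sat s Y (δ q) → Sat s (X ∪ Y) (δ q′)

  record IsSimpleLWAA : Set₁ where
    field
      isLWAA : IsLWAA
      simple : IsSimple

data LTL (n : ℕ) : Set where
  lit⁺    : Fin n → LTL n
  lit⁻    : Fin n → LTL n
  _∧ₗ_    : LTL n → LTL n → LTL n
  _∨ₗ_    : LTL n → LTL n → LTL n
  𝐗       : LTL n → LTL n
  _𝐔_     : LTL n → LTL n → LTL n
  _𝐕_     : LTL n → LTL n → LTL n

data _⊑_ {n : ℕ} : LTL n → LTL n → Set where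
  here : ∀ {φ} → φ ⊑ φ
  ∧ˡ : ∀ {ψ a b} → ψ ⊑ a → ψ ⊑ (a ∧ₗ b)
  ∧ʳ : ∀ {ψ a b} → ψ ⊑ b → ψ ⊑ (a ∧ₗ b)
  ∨ˡ : ∀ {ψ a b} → ψ ⊑ a → ψ ⊑ (a ∨ₗ b)
  ∨ʳ : ∀ {ψ a b} → ψ ⊑ b → ψ ⊑ (a ∨ₗ b)
  𝐗ᵢ : ∀ {ψ a}   → ψ ⊑ a → ψ ⊑ 𝐗 a
  𝐔ˡ : ∀ {ψ a b} → ψ ⊑ a → ψ ⊑ (a 𝐔 b)
  𝐔ʳ : ∀ {ψ a b} → ψ ⊑ b → ψ ⊑ (a 𝐔 b)
  𝐕ˡ : ∀ {ψ a b} → ψ ⊑ a → ψ ⊑ (a 𝐕 b)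
  𝐕ʳ : ∀ {ψ a b} → ψ ⊑ b → ψ ⊑ (a 𝐕 b)

-- Location q_ψ is represented by the formula ψ itself.
δ-LTL : {n : ℕ} → LTL n → PF (Fin n) (LTL n)
δ-LTL (lit⁺ v)  = pos v
δ-LTL (lit⁻ v)  = neg v
δ-LTL (a ∧ₗ b)  = δ-LTL a ∧ᵖ δ-LTL b
δ-LTL (a ∨ₗ b)  = δ-LTL a ∨ᵖ δ-LTL b
δ-LTL (𝐗 a)     = loc a
δ-LTL (a 𝐔 b)   = δ-LTL b ∨ᵖ (δ-LTL a ∧ᵖ loc (a 𝐔 b))
δ-LTL (a 𝐕 b)   = δ-LTL b ∧ᵖ (δ-LTL a ∨ᵖ loc (a 𝐕 b))

IsUntil : {n : ℕ} → LTL n → Set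
IsUntil ψ = ∃₂ λ a b → ψ ≡ (a 𝐔 b)

𝒜 : {n : ℕ} → LTL n → LWAAData (Fin n) (LTL n)
𝒜 φ = record
  { Q  = λ ψ → ψ ⊑ φ
  ; q₀ = φ
  ; δ  = δ-LTL
  ; F  = λ ψ → ψ ⊑ φ × IsUntil ψ
  }

NoNextUntil : {n : ℕ} → LTL n → Set
NoNextUntil φ = ∀ χ χ′ → ¬ (𝐗 (χ 𝐔 χ′) ⊑ φ)

-- Locations of 𝒜_φ are subformulas of φ and transitions only lead to
-- subformulas, so reachability is contained in the subformula order, which
-- is antisymmetric because proper subformulas are strictly smaller.
-- For the simplicity condition, let q = q_{a 𝐔 b} with q ∉ Y and s ∪ Y ⊨ δ(q); then
-- s ∪ Y ⊨ δ(b).  In δ(q′) the location q occurs only under some 𝐗, which is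
-- excluded, or as the loop δ(a) ∧ q inside δ(q), whose sibling disjunct δ(b)
-- is then satisfied by Y; so trading q for Y preserves satisfaction.
module Submission where

open import Defs
open import Data.Fin using (Fin)
open import Data.Nat using (ℕ; suc; _+_; _≤_; _<_; s≤s)
open import Data.Nat.Properties using (≤-trans; ≤-reflexive; <⇒≤; <⇒≱; m≤m+n; m≤n+m)
open import Data.Product using (_,_; proj₁)
open import Data.Sum using (inj₁; inj₂; _⊎_; [_,_]′)
open import Function using (id; _∘_; flip)
open import Level using (0ℓ)
open import Relation.Nullary using (¬_; contradiction)
open import Relation.Unary using (Pred; _∉_; _⊆_; _∪_; ｛_｝)
open import Relation.Binary.PropositionalEquality using (_≡_; refl; cong)
open import Relation.Binary.Construct.Closure.ReflexiveTransitive using (Star; fold)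

Sat-mono : {V L : Set} {s : Pred V 0ℓ} {X Y : Pred L 0ℓ} (θ : PF V L) →
           X ⊆ Y → Sat s X θ → Sat s Y θ
Sat-mono (pos v)   X⊆Y x        = x
Sat-mono (neg v)   X⊆Y x        = x
Sat-mono (loc q)   X⊆Y x        = X⊆Y x
Sat-mono (θ ∧ᵖ θ′) X⊆Y (x , x′) = Sat-mono θ X⊆Y x , Sat-mono θ′ X⊆Y x′
Sat-mono (θ ∨ᵖ θ′) X⊆Y (inj₁ x) = inj₁ (Sat-mono θ X⊆Y x)
Sat-mono (θ ∨ᵖ θ′) X⊆Y (inj₂ x) = inj₂ (Sat-mono θ′ X⊆Y x)

module _ {n : ℕ} where

  size : LTL n → ℕ
  size (lit⁺ _) = 1
  size (lit⁻ _) = 1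
  size (a ∧ₗ b) = suc (size a + size b)
  size (a ∨ₗ b) = suc (size a + size b)
  size (𝐗 a)    = suc (size a)
  size (a 𝐔 b)  = suc (size a + size b)
  size (a 𝐕 b)  = suc (size a + size b)

  ⊑-trans : {a b c : LTL n} → a ⊑ b → b ⊑ c → a ⊑ c
  ⊑-trans p here   = p
  ⊑-trans p (∧ˡ q) = ∧ˡ (⊑-trans p q)
  ⊑-trans p (∧ʳ q) = ∧ʳ (⊑-trans p q)
  ⊑-trans p (∨ˡ q) = ∨ˡ (⊑-trans p q)
  ⊑-trans p (∨ʳ q) = ∨ʳ (⊑-trans p q)
  ⊑-trans p (𝐗ᵢ q) = 𝐗ᵢ (⊑-trans p q)
  ⊑-trans p (𝐔ˡ q) = 𝐔ˡ (⊑-trans p q)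
  ⊑-trans p (𝐔ʳ q) = 𝐔ʳ (⊑-trans p q)
  ⊑-trans p (𝐕ˡ q) = 𝐕ˡ (⊑-trans p q)
  ⊑-trans p (𝐕ʳ q) = 𝐕ʳ (⊑-trans p q)

  ⊑⇒≡⊎size< : {a b : LTL n} → a ⊑ b → a ≡ b ⊎ size a < size b
  ⊑⇒size≤  : {a b : LTL n} → a ⊑ b → size a ≤ size b

  ⊑⇒≡⊎size< here   = inj₁ refl
  ⊑⇒≡⊎size< (∧ˡ p) = inj₂ (s≤s (≤-trans (⊑⇒size≤ p) (m≤m+n _ _)))
  ⊑⇒≡⊎size< (∧ʳ p) = inj₂ (s≤s (≤-trans (⊑⇒size≤ p) (m≤n+m _ _)))
  ⊑⇒≡⊎size< (∨ˡ p) = inj₂ (s≤s (≤-trans (⊑⇒size≤ p) (m≤m+n _ _)))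
  ⊑⇒≡⊎size< (∨ʳ p) = inj₂ (s≤s (≤-trans (⊑⇒size≤ p) (m≤n+m _ _)))
  ⊑⇒≡⊎size< (𝐗ᵢ p) = inj₂ (s≤s (⊑⇒size≤ p))
  ⊑⇒≡⊎size< (𝐔ˡ p) = inj₂ (s≤s (≤-trans (⊑⇒size≤ p) (m≤m+n _ _)))
  ⊑⇒≡⊎size< (𝐔ʳ p) = inj₂ (s≤s (≤-trans (⊑⇒size≤ p) (m≤n+m _ _)))
  ⊑⇒≡⊎size< (𝐕ˡ p) = inj₂ (s≤s (≤-trans (⊑⇒size≤ p) (m≤m+n _ _)))
  ⊑⇒≡⊎size< (𝐕ʳ p) = inj₂ (s≤s (≤-trans (⊑⇒size≤ p) (m≤n+m _ _)))

  ⊑⇒size≤ p = [ ≤-reflexive ∘ cong size , <⇒≤ ]′ (⊑⇒≡⊎size< p)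

  ⊑-antisym : {a b : LTL n} → a ⊑ b → b ⊑ a → a ≡ b
  ⊑-antisym a⊑b b⊑a =
    [ id , (λ a<b → contradiction (⊑⇒size≤ b⊑a) (<⇒≱ a<b)) ]′ (⊑⇒≡⊎size< a⊑b)

  Occurs-δ⇒⊑ : (ψ : LTL n) {r : LTL n} → Occurs r (δ-LTL ψ) → r ⊑ ψ
  Occurs-δ⇒⊑ (a ∧ₗ b) (inj₁ o)           = ∧ˡ (Occurs-δ⇒⊑ a o)
  Occurs-δ⇒⊑ (a ∧ₗ b) (inj₂ o)           = ∧ʳ (Occurs-δ⇒⊑ b o)
  Occurs-δ⇒⊑ (a ∨ₗ b) (inj₁ o)           = ∨ˡ (Occurs-δ⇒⊑ a o)
  Occurs-δ⇒⊑ (a ∨ₗ b) (inj₂ o)           = ∨ʳ (Occurs-δ⇒⊑ b o)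
  Occurs-δ⇒⊑ (𝐗 a)    refl               = 𝐗ᵢ here
  Occurs-δ⇒⊑ (a 𝐔 b)  (inj₁ o)           = 𝐔ʳ (Occurs-δ⇒⊑ b o)
  Occurs-δ⇒⊑ (a 𝐔 b)  (inj₂ (inj₁ o))    = 𝐔ˡ (Occurs-δ⇒⊑ a o)
  Occurs-δ⇒⊑ (a 𝐔 b)  (inj₂ (inj₂ refl)) = here
  Occurs-δ⇒⊑ (a 𝐕 b)  (inj₁ o)           = 𝐕ʳ (Occurs-δ⇒⊑ b o)
  Occurs-δ⇒⊑ (a 𝐕 b)  (inj₂ (inj₁ o))    = 𝐕ˡ (Occurs-δ⇒⊑ a o)
  Occurs-δ⇒⊑ (a 𝐕 b)  (inj₂ (inj₂ refl)) = here

  Star-Step⇒⊒ : (φ : LTL n) {q q′ : LTL n} → Star (Step (𝒜 φ)) q q′ → q′ ⊑ q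
  Star-Step⇒⊒ _ = fold (flip _⊑_) (λ {q} step r⊑q′ → ⊑-trans r⊑q′ (Occurs-δ⇒⊑ q step)) here

  𝒜-isLWAA : (φ : LTL n) → IsLWAA (𝒜 φ)
  𝒜-isLWAA φ = record
    { q₀∈Q    = here
    ; F⊆Q     = proj₁
    ; δ-in-Q  = λ {q} q⊑φ step → ⊑-trans (Occurs-δ⇒⊑ q step) q⊑φ
    ; antisym = λ _ _ q→q′ q′→q → ⊑-antisym (Star-Step⇒⊒ φ q′→q) (Star-Step⇒⊒ φ q→q′)
    }

  Sat-δ-trade-until : {a b : LTL n} {s : Pred (Fin n) 0ℓ} {X Y : Pred (LTL n) 0ℓ}
    (ψ : LTL n) → ¬ 𝐗 (a 𝐔 b) ⊑ ψ → Sat s Y (δ-LTL b) →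
    Sat s (X ∪ ｛ a 𝐔 b ｝) (δ-LTL ψ) → Sat s (X ∪ Y) (δ-LTL ψ)
  Sat-δ-trade-until (lit⁺ v) _ _ x = x
  Sat-δ-trade-until (lit⁻ v) _ _ x = x
  Sat-δ-trade-until (c ∧ₗ d) h Y⊨b (x , y) =
    Sat-δ-trade-until c (h ∘ ∧ˡ) Y⊨b x , Sat-δ-trade-until d (h ∘ ∧ʳ) Y⊨b y
  Sat-δ-trade-until (c ∨ₗ d) h Y⊨b (inj₁ x) = inj₁ (Sat-δ-trade-until c (h ∘ ∨ˡ) Y⊨b x)
  Sat-δ-trade-until (c ∨ₗ d) h Y⊨b (inj₂ y) = inj₂ (Sat-δ-trade-until d (h ∘ ∨ʳ) Y⊨b y)
  Sat-δ-trade-until (𝐗 c) _ _ (inj₁ c∈X)  = inj₁ c∈X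
  Sat-δ-trade-until (𝐗 c) h _ (inj₂ refl) = contradiction here h
  Sat-δ-trade-until (c 𝐔 d) h Y⊨b (inj₁ x) = inj₁ (Sat-δ-trade-until d (h ∘ 𝐔ʳ) Y⊨b x)
  Sat-δ-trade-until (c 𝐔 d) h Y⊨b (inj₂ (x , inj₁ cUd∈X)) =
    inj₂ (Sat-δ-trade-until c (h ∘ 𝐔ˡ) Y⊨b x , inj₁ cUd∈X)
  Sat-δ-trade-until {b = b} (c 𝐔 d) _ Y⊨b (inj₂ (_ , inj₂ refl)) =
    inj₁ (Sat-mono (δ-LTL b) inj₂ Y⊨b)
  Sat-δ-trade-until (c 𝐕 d) h Y⊨b (x , inj₁ y) =
    Sat-δ-trade-until d (h ∘ 𝐕ʳ) Y⊨b x , inj₁ (Sat-δ-trade-until c (h ∘ 𝐕ˡ) Y⊨b y)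
  Sat-δ-trade-until (c 𝐕 d) h Y⊨b (x , inj₂ (inj₁ cVd∈X)) =
    Sat-δ-trade-until d (h ∘ 𝐕ʳ) Y⊨b x , inj₂ (inj₁ cVd∈X)

  Sat-δ-until⇒Sat-δ-right : {a b : LTL n} {s : Pred (Fin n) 0ℓ} {Y : Pred (LTL n) 0ℓ} →
    (a 𝐔 b) ∉ Y → Sat s Y (δ-LTL (a 𝐔 b)) → Sat s Y (δ-LTL b)
  Sat-δ-until⇒Sat-δ-right _   (inj₁ Y⊨b)       = Y⊨b
  Sat-δ-until⇒Sat-δ-right q∉Y (inj₂ (_ , q∈Y)) = contradiction q∈Y q∉Y

  NoNextUntil-⊑ : {ψ φ : LTL n} → ψ ⊑ φ → NoNextUntil φ → NoNextUntil ψ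
  NoNextUntil-⊑ ψ⊑φ h χ χ′ = h χ χ′ ∘ flip ⊑-trans ψ⊑φ

  𝒜-simple : (φ : LTL n) → NoNextUntil φ → IsSimple (𝒜 φ)
  𝒜-simple φ h .(a 𝐔 b) q′ s X Y (_ , a , b , refl) q′⊑φ _ _ _ q∉Y X∪q⊨δq′ Y⊨δq =
    Sat-δ-trade-until q′ (NoNextUntil-⊑ q′⊑φ h a b)
      (Sat-δ-until⇒Sat-δ-right {a = a} q∉Y Y⊨δq) X∪q⊨δq′

theorem3 : (n : ℕ) (φ : LTL n) → NoNextUntil φ → IsSimpleLWAA (𝒜 φ)
theorem3 n φ h = record { isLWAA = 𝒜-isLWAA φ ; simple = 𝒜-simple φ h }
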